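{- Consider the Cohn tree $\mathrm{Tree}(\mathrm{Co})$ (defined in the context). Then: (1) For every vertex $(u,v)$ of the Cohn tree, $u$, $v$ and the concatenation $uv$ are Christoffel words. (2) Replacing each vertex $(u,v)$ of the Cohn tree by $\dfrac{|u|}{|v|}$ yields the Stern–Brocot tree (as rooted binary trees with left and right children). (3) Replacing each vertex $(u,v)$ of the Cohn tree by $\dfrac{|uv|_b}{|uv|_a}$ yields the Calkin–Wilf tree (as rooted binary trees with left and right children).
   Context: Words are over the alphabet $\{a,b\}$; $|w|$ is the length of $w$ and $|w|_x$ the number of occurrences of the letter $x$ in $w$. For coprime integers $x,y\ge0$ (not both zero), the lower Christoffel path of slope $y/x$ is the lattice path from $(0,0)$ to $(x,y)$ with unit steps $(1,0)$ and $(0,1)$ that never goes above the segment from $(0,0)$ to $(x,y)$ and such that no point of $\mathbb{Z}^2$ lies in the interior of the region enclosed by the path and the segment; the Christoffel word of slope $y/x$ records $a$ for each horizontal step and $b$ for each vertical step. A Christoffel word is a word arising this way. The Cohn triple tree is the full binary tree with root $(a,b,ab)$ in which a vertex $(u,v,w)$ has left child obtained by applying to each of $u,v,w$ the substitution $a\mapsto a$, $b\mapsto ab$, and right child obtained by applying the substitution $a\mapsto ab$, $b\mapsto b$. The Cohn tree is obtained by replacing each vertex $(u,v,w)$ of the Cohn triple tree by $(u,v)$. The Calkin–Wilf tree is the full binary tree with root $1/1$ where $x/y$ has left child $x/(x+y)$ and right child $(x+y)/y$. The Stern–Brocot tree is the full binary tree whose vertices carry a fraction and a pair of neighbours: the root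 is $1/1$ with left neighbour $0/1$ and right neighbour $1/0$; a vertex $\frac{a+c}{b+d}$ with left neighbour $\frac ab$ and right neighbour $\frac cd$ has left child $\frac{2a+c}{2b+d}$ (neighbours $\frac ab,\frac{a+c}{b+d}$) and right child $\frac{a+2c}{b+2d}$ (neighbours $\frac{a+c}{b+d},\frac cd$). -}

module Defs where

open import Data.Nat using (ℕ; zero; suc; _+_; _*_; _≤_; _<_)
open import Data.Nat.Coprimality using (Coprime)
open import Data.List using (List; []; _∷_; _++_; take; concatMap)
open import Data.Product using (_×_; _,_; ∃; ∃-syntax; proj₁; proj₂)
open import Relation.Binary.PropositionalEquality using (_≡_)

data Letter : Set where
  a b : Letter

Word : Set
Word = List Letter

count : Letter → Word → ℕ
count x [] = 0
count a (a ∷ w) = suc (count a w)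
count a (b ∷ w) = count a w
count b (a ∷ w) = count b w
count b (b ∷ w) = suc (count b w)

-- The lattice path of w: after k steps it is at the point
-- (|take k w|_a , |take k w|_b)  (a = step (1,0), b = step (0,1)).
-- w is the lower Christoffel path of slope y/x (x, y coprime) iff
--  * it goes from (0,0) to (x,y),
--  * it never goes above the segment from (0,0) to (x,y)
--    (point (i,j) is not above iff j*x ≤ i*y),
--  * no lattice point lies in the interior of the region enclosed by the
--    path and the segment: every lattice point (i,j) with 0 ≤ i ≤ x lying
--    strictly below the segment (j*x < i*y) is NOT strictly above the path,
--    i.e. the path has a point (i,j') in column i with j ≤ j'.
record IsLowerChristoffel (x y : ℕ) (w : Word) : Set where
  field
    coprime   : Coprime x y
    endA      : count a w ≡ x
    endB      : count b w ≡ y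
    below     : ∀ k → count b (take k w) * x ≤ count a (take k w) * y
    noInterior : ∀ i j → i ≤ x → j * x < i * y →
                 ∃[ k ] (count a (take k w) ≡ i × j ≤ count b (take k w))

IsChristoffel : Word → Set
IsChristoffel w = ∃[ x ] ∃[ y ] IsLowerChristoffel x y w

-- Directions in a full binary tree; a vertex is addressed by the list of
-- directions from the root (root first).
data Dir : Set where
  L R : Dir

substL : Letter → Word
substL a = a ∷ []
substL b = a ∷ b ∷ []

substR : Letter → Word
substR a = a ∷ b ∷ []
substR b = b ∷ []

applyDir : Dir → Word → Word
applyDir L = concatMap substL
applyDir R = concatMap substR

Triple : Set
Triple = Word × Word × Word

childTriple : Dir → Triple → Triple
childTriple d (u , v , w) = applyDir d u , applyDir d v , applyDir d w

cohnTripleFrom : Triple → List Dir → Triple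
cohnTripleFrom t [] = t
cohnTripleFrom t (d ∷ ds) = cohnTripleFrom (childTriple d t) ds

cohnTriple : List Dir → Triple
cohnTriple = cohnTripleFrom (a ∷ [] , b ∷ [] , a ∷ b ∷ [])

cohn : List Dir → Word × Word
cohn p with cohnTriple p
... | (u , v , _) = u , v

-- Fractions p/q are represented as pairs (p , q) of naturals (numerator,
-- denominator); 1/0 is allowed as a Stern–Brocot neighbour.
Frac : Set
Frac = ℕ × ℕ

_≈F_ : Frac → Frac → Set
(p , q) ≈F (r , s) = p * s ≡ r * q

cwFrom : Frac → List Dir → Frac
cwFrom f [] = f
cwFrom (x , y) (L ∷ ds) = cwFrom (x , x + y) ds
cwFrom (x , y) (R ∷ ds) = cwFrom (x + y , y) ds

calkinWilf : List Dir → Frac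
calkinWilf = cwFrom (1 , 1)

-- Stern–Brocot tree: a vertex is given by its pair of neighbours
-- (a/b , c/d); its fraction is the mediant (a+c)/(b+d).
SBNode : Set
SBNode = Frac × Frac

sbFraction : SBNode → Frac
sbFraction ((p , q) , (r , s)) = p + r , q + s

sbChild : Dir → SBNode → SBNode
sbChild L ((p , q) , (r , s)) = (p , q) , (p + r , q + s)
sbChild R ((p , q) , (r , s)) = (p + r , q + s) , (r , s)

sbFrom : SBNode → List Dir → SBNode
sbFrom n [] = n
sbFrom n (d ∷ ds) = sbFrom (sbChild d n) ds

sternBrocot : List Dir → Frac
sternBrocot p = sbFraction (sbFrom ((0 , 1) , (1 , 0)) p)

-- Let ψ_p be the composite of the substitutions φ_L, φ_R along the path p.
-- Then the Cohn tree has vertex (ψ_p a, ψ_p b) at p, and ψ_p(ab) = ψ_p a ψ_p b,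
-- so the children of (u, v) are (u, uv) and (uv, v).
--
-- (2), (3): counting letters, φ_L and φ_R act on the pairs (|w|_b, |w|_a)
-- exactly as the Stern–Brocot and Calkin–Wilf rules.
--
-- (1): call a word of length n mechanical of slope y/n if its prefix of
-- length k contains ⌊k y / n⌋ letters b. With x, y coprime, the mechanical
-- word of slope y/(x+y) is the Christoffel word of slope y/x. If
-- y₁/n₁ < y₂/n₂ are Farey neighbours (y₂ n₁ − y₁ n₂ = 1), the concatenation
-- of their mechanical words is the mechanical word of the mediant. Along the
-- Cohn tree (u, v) always consists of the mechanical words of two Farey
-- neighbours, so u, v and uv are Christoffel words.
module Submission where

open import Defs
open import Data.List using (List; []; _∷_; _++_; length; take)
open import Data.Product using (_×_; _,_; proj₁; proj₂; ∃-syntax)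
open import Data.List.Properties using (concatMap-++; length-++; length-take; take-all)
open import Data.Nat using (ℕ; zero; suc; _+_; _*_; _∸_; _≤_; _<_; _≤?_; z≤n; s≤s; NonZero; >-nonZero; >-nonZero⁻¹)
open import Data.Nat.Properties
open import Data.Nat.DivMod using (_/_; _%_; m≡m%n+[m/n]*n; m%n<n; m/n*n≤m)
open import Data.Nat.Divisibility using (_∣_; ∣1⇒≡1; ∣m+n∣m⇒∣n; ∣m⇒∣m*n; ∣n⇒∣m*n)
open import Data.Nat.Coprimality using (Coprime)
open import Data.Nat.Tactic.RingSolver using (solve)
open import Relation.Nullary using (yes; no)
open import Relation.Binary.PropositionalEquality

private
  variable
    A : Set
    k m n t x y : ℕ
    u v w : Word

count-++ : ∀ c (u v : Word) → count c (u ++ v) ≡ count c u + count c v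
count-++ a []      v = refl
count-++ b []      v = refl
count-++ a (a ∷ u) v = cong suc (count-++ a u v)
count-++ a (b ∷ u) v = count-++ a u v
count-++ b (a ∷ u) v = count-++ b u v
count-++ b (b ∷ u) v = cong suc (count-++ b u v)

count-a+count-b : ∀ (w : Word) → count a w + count b w ≡ length w
count-a+count-b []      = refl
count-a+count-b (a ∷ w) = cong suc (count-a+count-b w)
count-a+count-b (b ∷ w) = trans (+-suc (count a w) (count b w)) (cong suc (count-a+count-b w))

count-b+count-a : ∀ (w : Word) → count b w + count a w ≡ length w
count-b+count-a w = trans (+-comm (count b w) (count a w)) (count-a+count-b w)

count-a-applyL : ∀ w → count a (applyDir L w) ≡ length w
count-a-applyL []      = refl
count-a-applyL (a ∷ w) = cong suc (count-a-applyL w)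
count-a-applyL (b ∷ w) = cong suc (count-a-applyL w)

count-b-applyL : ∀ w → count b (applyDir L w) ≡ count b w
count-b-applyL []      = refl
count-b-applyL (a ∷ w) = count-b-applyL w
count-b-applyL (b ∷ w) = cong suc (count-b-applyL w)

count-a-applyR : ∀ w → count a (applyDir R w) ≡ count a w
count-a-applyR []      = refl
count-a-applyR (a ∷ w) = cong suc (count-a-applyR w)
count-a-applyR (b ∷ w) = count-a-applyR w

count-b-applyR : ∀ w → count b (applyDir R w) ≡ length w
count-b-applyR []      = refl
count-b-applyR (a ∷ w) = cong suc (count-b-applyR w)
count-b-applyR (b ∷ w) = cong suc (count-b-applyR w)

applyPath : List Dir → Word → Word
applyPath []       w = w
applyPath (d ∷ ds) w = applyPath ds (applyDir d w)

applyDir-++ : ∀ d (u v : Word) → applyDir d (u ++ v) ≡ applyDir d u ++ applyDir d v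
applyDir-++ L = concatMap-++ substL
applyDir-++ R = concatMap-++ substR

applyPath-++ : ∀ p (u v : Word) → applyPath p (u ++ v) ≡ applyPath p u ++ applyPath p v
applyPath-++ []      u v = refl
applyPath-++ (d ∷ p) u v = trans (cong (applyPath p) (applyDir-++ d u v)) (applyPath-++ p _ _)

cohnTripleFrom-applyPath : ∀ p u v w →
  cohnTripleFrom (u , v , w) p ≡ (applyPath p u , applyPath p v , applyPath p w)
cohnTripleFrom-applyPath []      u v w = refl
cohnTripleFrom-applyPath (d ∷ p) u v w = cohnTripleFrom-applyPath p _ _ _

-- The Stern–Brocot and Calkin–Wilf trees

≡⇒≈F : ∀ {f g : Frac} → f ≡ g → f ≈F g
≡⇒≈F {p , q} refl = refl

sbNodeOf : Word → Word → SBNode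
sbNodeOf u v = (count b u , count b v) , (count a u , count a v)

sbChild-sbNodeOf : ∀ d u v → sbChild d (sbNodeOf u v) ≡ sbNodeOf (applyDir d u) (applyDir d v)
sbChild-sbNodeOf L u v
  rewrite count-b-applyL u | count-b-applyL v | count-a-applyL u | count-a-applyL v
        | count-b+count-a u | count-b+count-a v = refl
sbChild-sbNodeOf R u v
  rewrite count-b-applyR u | count-b-applyR v | count-a-applyR u | count-a-applyR v
        | count-b+count-a u | count-b+count-a v = refl

sbFrom-sbNodeOf : ∀ p u v → sbFrom (sbNodeOf u v) p ≡ sbNodeOf (applyPath p u) (applyPath p v)
sbFrom-sbNodeOf []      u v = refl
sbFrom-sbNodeOf (d ∷ p) u v =
  trans (cong (λ node → sbFrom node p) (sbChild-sbNodeOf d u v)) (sbFrom-sbNodeOf p _ _)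

sbFraction-sbNodeOf : ∀ u v → sbFraction (sbNodeOf u v) ≡ (length u , length v)
sbFraction-sbNodeOf u v = cong₂ _,_ (count-b+count-a u) (count-b+count-a v)

cohn-sternBrocot : ∀ (p : List Dir) →
  (length (proj₁ (cohn p)) , length (proj₂ (cohn p))) ≈F sternBrocot p
cohn-sternBrocot p rewrite cohnTripleFrom-applyPath p (a ∷ []) (b ∷ []) (a ∷ b ∷ []) = ≡⇒≈F (begin
  (length (applyPath p (a ∷ [])) , length (applyPath p (b ∷ [])))
    ≡⟨ sbFraction-sbNodeOf (applyPath p (a ∷ [])) (applyPath p (b ∷ [])) ⟨
  sbFraction (sbNodeOf (applyPath p (a ∷ [])) (applyPath p (b ∷ [])))
    ≡⟨ cong sbFraction (sbFrom-sbNodeOf p (a ∷ []) (b ∷ [])) ⟨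
  sternBrocot p ∎)
  where open ≡-Reasoning

cwOf : Word → Frac
cwOf w = count b w , count a w

cwFrom-cwOf : ∀ p w → cwFrom (cwOf w) p ≡ cwOf (applyPath p w)
cwFrom-cwOf []      w = refl
cwFrom-cwOf (L ∷ p) w = trans (cong (λ f → cwFrom f p) step) (cwFrom-cwOf p _)
  where
  step : (count b w , count b w + count a w) ≡ cwOf (applyDir L w)
  step = cong₂ _,_ (sym (count-b-applyL w)) (trans (count-b+count-a w) (sym (count-a-applyL w)))
cwFrom-cwOf (R ∷ p) w = trans (cong (λ f → cwFrom f p) step) (cwFrom-cwOf p _)
  where
  step : (count b w + count a w , count a w) ≡ cwOf (applyDir R w)
  step = cong₂ _,_ (trans (count-b+count-a w) (sym (count-b-applyR w))) (sym (count-a-applyR w))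

cohn-calkinWilf : ∀ (p : List Dir) →
  (count b (proj₁ (cohn p) ++ proj₂ (cohn p)) , count a (proj₁ (cohn p) ++ proj₂ (cohn p)))
    ≈F calkinWilf p
cohn-calkinWilf p rewrite cohnTripleFrom-applyPath p (a ∷ []) (b ∷ []) (a ∷ b ∷ []) = ≡⇒≈F (begin
  cwOf (applyPath p (a ∷ []) ++ applyPath p (b ∷ [])) ≡⟨ cong cwOf (applyPath-++ p _ _) ⟨
  cwOf (applyPath p (a ∷ b ∷ []))                     ≡⟨ cwFrom-cwOf p (a ∷ b ∷ []) ⟨
  calkinWilf p                                        ∎)
  where open ≡-Reasoning

infix 4 ⌊_/_⌋≡_

record ⌊_/_⌋≡_ (m n q : ℕ) : Set where
  constructor bounds
  field
    lower : q * n ≤ m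
    upper : m < suc q * n

open ⌊_/_⌋≡_ using (lower; upper)

⌊/⌋-unique : ∀ {m n q q′} → ⌊ m / n ⌋≡ q → ⌊ m / n ⌋≡ q′ → q ≡ q′
⌊/⌋-unique {m} {n} (bounds lower upper) (bounds lower′ upper′) =
  ≤-antisym (below lower upper′) (below lower′ upper)
  where
  below : ∀ {r s} → r * n ≤ m → m < suc s * n → r ≤ s
  below {r} {s} r*n≤m m<[1+s]*n = ≤-pred (*-cancelʳ-< n r (suc s) (≤-<-trans r*n≤m m<[1+s]*n))

⌊n*y/n⌋≡y : ∀ n y .{{_ : NonZero n}} → ⌊ n * y / n ⌋≡ y
⌊n*y/n⌋≡y n y =
  bounds (≤-reflexive (*-comm y n)) (subst (_< suc y * n) (*-comm y n) (m<n+m (y * n) (>-nonZero⁻¹ n)))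

⌊/⌋-divMod : ∀ m n .{{_ : NonZero n}} → ⌊ m / n ⌋≡ (m / n)
⌊/⌋-divMod m n = bounds (m/n*n≤m m n) (begin-strict
  m                 ≡⟨ m≡m%n+[m/n]*n m n ⟩
  m % n + m / n * n <⟨ +-monoˡ-< (m / n * n) (m%n<n m n) ⟩
  n + m / n * n     ∎)
  where open ≤-Reasoning

-- The shear (i, j) ↦ (i + j, j) maps the line of slope y/x onto the line
-- of slope y/(x + y) and preserves which lattice points lie below it.
⌊/⌋-shear : ∀ {i y x q} → ⌊ i * y / x ⌋≡ q → ⌊ (i + q) * y / (x + y) ⌋≡ q
⌊/⌋-shear {i} {y} {x} {q} (bounds lower upper) = bounds lower′ upper′
  where
  open ≤-Reasoning
  lower′ : q * (x + y) ≤ (i + q) * y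
  lower′ = begin
    q * (x + y)   ≡⟨ *-distribˡ-+ q x y ⟩
    q * x + q * y ≤⟨ +-monoˡ-≤ (q * y) lower ⟩
    i * y + q * y ≡⟨ *-distribʳ-+ y i q ⟨
    (i + q) * y   ∎
  upper′ : (i + q) * y < suc q * (x + y)
  upper′ = begin-strict
    (i + q) * y           ≡⟨ *-distribʳ-+ y i q ⟩
    i * y + q * y         <⟨ +-monoˡ-< (q * y) upper ⟩
    suc q * x + q * y     ≤⟨ +-monoʳ-≤ (suc q * x) (m≤n+m (q * y) y) ⟩
    suc q * x + suc q * y ≡⟨ *-distribˡ-+ (suc q) x y ⟨
    suc q * (x + y)       ∎

-- Mediants of Farey neighbours

frac-≤-trans : ∀ {m k y n y′ n′} .{{_ : NonZero n}} →
  m * n ≤ k * y → y * n′ ≤ y′ * n → m * n′ ≤ k * y′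
frac-≤-trans {m} {k} {y} {n} {y′} {n′} m/k≤y/n y/n≤y′/n′ = *-cancelʳ-≤ (m * n′) (k * y′) n (begin
  m * n′ * n   ≡⟨ solve (m ∷ n ∷ n′ ∷ []) ⟩
  m * n * n′   ≤⟨ *-monoˡ-≤ n′ m/k≤y/n ⟩
  k * y * n′   ≡⟨ *-assoc k y n′ ⟩
  k * (y * n′) ≤⟨ *-monoʳ-≤ k y/n≤y′/n′ ⟩
  k * (y′ * n) ≡⟨ *-assoc k y′ n ⟨
  k * y′ * n   ∎)
  where open ≤-Reasoning

frac-≤-<-trans : ∀ {k m y n y′ n′} .{{_ : NonZero n}} .{{_ : NonZero n′}} →
  y * n′ ≤ y′ * n → k * y′ < m * n′ → k * y < m * n
frac-≤-<-trans {k} {m} {y} {n} {y′} {n′} y/n≤y′/n′ y′/n′<m/k =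
  *-cancelʳ-< n′ (k * y) (m * n) (begin-strict
  k * y * n′   ≡⟨ *-assoc k y n′ ⟩
  k * (y * n′) ≤⟨ *-monoʳ-≤ k y/n≤y′/n′ ⟩
  k * (y′ * n) ≡⟨ *-assoc k y′ n ⟨
  k * y′ * n   <⟨ *-monoˡ-< n y′/n′<m/k ⟩
  m * n′ * n   ≡⟨ solve (m ∷ n′ ∷ n ∷ []) ⟩
  m * n * n′   ∎)
  where open ≤-Reasoning

module FareyMediant {n₁ y₁ n₂ y₂ : ℕ} .{{_ : NonZero n₁}} .{{_ : NonZero n₂}}
                    (det : y₂ * n₁ ≡ y₁ * n₂ + 1) where

  y₁/n₁≤y₂/n₂ : y₁ * n₂ ≤ y₂ * n₁
  y₁/n₁≤y₂/n₂ = subst (y₁ * n₂ ≤_) (sym det) (m≤m+n (y₁ * n₂) 1)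

  ⌊/⌋-mediantˡ : k ≤ n₁ → ⌊ k * y₁ / n₁ ⌋≡ m → ⌊ k * (y₁ + y₂) / (n₁ + n₂) ⌋≡ m
  ⌊/⌋-mediantˡ {k} {m} k≤n₁ (bounds lower upper) = bounds lower′ (*-cancelʳ-< n₁ _ _ upper′)
    where
    open ≤-Reasoning
    m*n₂≤k*y₂ : m * n₂ ≤ k * y₂
    m*n₂≤k*y₂ = frac-≤-trans {m} {k} {y₁} {n₁} {y₂} {n₂} lower y₁/n₁≤y₂/n₂
    lower′ : m * (n₁ + n₂) ≤ k * (y₁ + y₂)
    lower′ = begin
      m * (n₁ + n₂)   ≡⟨ *-distribˡ-+ m n₁ n₂ ⟩
      m * n₁ + m * n₂ ≤⟨ +-mono-≤ lower m*n₂≤k*y₂ ⟩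
      k * y₁ + k * y₂ ≡⟨ *-distribˡ-+ k y₁ y₂ ⟨
      k * (y₁ + y₂)   ∎
    k<n₁+n₂ : k < n₁ + n₂
    k<n₁+n₂ = ≤-<-trans k≤n₁ (m<m+n n₁ (>-nonZero⁻¹ n₂))
    upper′ : k * (y₁ + y₂) * n₁ < suc m * (n₁ + n₂) * n₁
    upper′ = begin-strict
      k * (y₁ + y₂) * n₁                ≡⟨ solve (k ∷ y₁ ∷ y₂ ∷ n₁ ∷ []) ⟩
      k * y₁ * n₁ + k * (y₂ * n₁)       ≡⟨ cong (λ z → k * y₁ * n₁ + k * z) det ⟩
      k * y₁ * n₁ + k * (y₁ * n₂ + 1)   ≡⟨ solve (k ∷ y₁ ∷ n₁ ∷ n₂ ∷ []) ⟩
      k * y₁ * (n₁ + n₂) + k            <⟨ +-monoʳ-< (k * y₁ * (n₁ + n₂)) k<n₁+n₂ ⟩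
      k * y₁ * (n₁ + n₂) + (n₁ + n₂)    ≡⟨ +-comm (k * y₁ * (n₁ + n₂)) (n₁ + n₂) ⟩
      suc (k * y₁) * (n₁ + n₂)          ≤⟨ *-monoˡ-≤ (n₁ + n₂) upper ⟩
      suc m * n₁ * (n₁ + n₂)            ≡⟨ solve (m ∷ n₁ ∷ n₂ ∷ []) ⟩
      suc m * (n₁ + n₂) * n₁            ∎

  expand : ∀ t → (n₁ + t) * (y₁ + y₂) ≡ y₁ * (n₁ + n₂) + suc (t * y₁ + t * y₂)
  expand t = begin
    (n₁ + t) * (y₁ + y₂)                         ≡⟨ solve (n₁ ∷ t ∷ y₁ ∷ y₂ ∷ []) ⟩
    n₁ * y₁ + y₂ * n₁ + (t * y₁ + t * y₂)        ≡⟨ cong (λ z → n₁ * y₁ + z + (t * y₁ + t * y₂)) det ⟩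
    n₁ * y₁ + (y₁ * n₂ + 1) + (t * y₁ + t * y₂)  ≡⟨ solve (n₁ ∷ n₂ ∷ t ∷ y₁ ∷ y₂ ∷ []) ⟩
    y₁ * (n₁ + n₂) + suc (t * y₁ + t * y₂)       ∎
    where open ≡-Reasoning

  ⌊/⌋-mediantʳ : t ≤ n₂ → ⌊ t * y₂ / n₂ ⌋≡ m → ⌊ (n₁ + t) * (y₁ + y₂) / (n₁ + n₂) ⌋≡ y₁ + m
  ⌊/⌋-mediantʳ {t} {m} t≤n₂ (bounds lower upper) = bounds lower′ upper′
    where
    open ≤-Reasoning
    m*n₁≤1+t*y₁ : m * n₁ ≤ suc (t * y₁)
    m*n₁≤1+t*y₁ = *-cancelʳ-≤ (m * n₁) (suc (t * y₁)) n₂ (begin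
      m * n₁ * n₂          ≡⟨ solve (m ∷ n₁ ∷ n₂ ∷ []) ⟩
      m * n₂ * n₁          ≤⟨ *-monoˡ-≤ n₁ lower ⟩
      t * y₂ * n₁          ≡⟨ *-assoc t y₂ n₁ ⟩
      t * (y₂ * n₁)        ≡⟨ cong (t *_) det ⟩
      t * (y₁ * n₂ + 1)    ≡⟨ solve (t ∷ y₁ ∷ n₂ ∷ []) ⟩
      t * y₁ * n₂ + t      ≤⟨ +-monoʳ-≤ (t * y₁ * n₂) t≤n₂ ⟩
      t * y₁ * n₂ + n₂     ≡⟨ +-comm (t * y₁ * n₂) n₂ ⟩
      suc (t * y₁) * n₂    ∎)
    t*y₁<[1+m]*n₁ : t * y₁ < suc m * n₁
    t*y₁<[1+m]*n₁ = frac-≤-<-trans {t} {suc m} {y₁} {n₁} {y₂} {n₂} y₁/n₁≤y₂/n₂ upper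
    lower′ : (y₁ + m) * (n₁ + n₂) ≤ (n₁ + t) * (y₁ + y₂)
    lower′ = begin
      (y₁ + m) * (n₁ + n₂)                   ≡⟨ solve (y₁ ∷ m ∷ n₁ ∷ n₂ ∷ []) ⟩
      y₁ * (n₁ + n₂) + (m * n₁ + m * n₂)     ≤⟨ +-monoʳ-≤ (y₁ * (n₁ + n₂)) (+-mono-≤ m*n₁≤1+t*y₁ lower) ⟩
      y₁ * (n₁ + n₂) + suc (t * y₁ + t * y₂) ≡⟨ expand t ⟨
      (n₁ + t) * (y₁ + y₂)                   ∎
    upper′ : (n₁ + t) * (y₁ + y₂) < suc (y₁ + m) * (n₁ + n₂)
    upper′ = begin-strict
      (n₁ + t) * (y₁ + y₂)                        ≡⟨ expand t ⟩
      y₁ * (n₁ + n₂) + suc (t * y₁ + t * y₂)      ≡⟨ cong (y₁ * (n₁ + n₂) +_) (+-suc (t * y₁) (t * y₂)) ⟨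
      y₁ * (n₁ + n₂) + (t * y₁ + suc (t * y₂))    <⟨ +-monoʳ-< (y₁ * (n₁ + n₂)) (+-mono-<-≤ t*y₁<[1+m]*n₁ upper) ⟩
      y₁ * (n₁ + n₂) + (suc m * n₁ + suc m * n₂)  ≡⟨ solve (y₁ ∷ m ∷ n₁ ∷ n₂ ∷ []) ⟩
      suc (y₁ + m) * (n₁ + n₂)                    ∎

-- Mechanical words

take-++ˡ : ∀ k (u v : List A) → k ≤ length u → take k (u ++ v) ≡ take k u
take-++ˡ zero    u       v _         = refl
take-++ˡ (suc k) (x ∷ u) v (s≤s k≤u) = cong (x ∷_) (take-++ˡ k u v k≤u)

take-++ʳ : ∀ t (u v : List A) → take (length u + t) (u ++ v) ≡ u ++ take t v
take-++ʳ t []      v = refl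
take-++ʳ t (x ∷ u) v = cong (x ∷_) (take-++ʳ t u v)

count-a+count-b-take : ∀ k (w : Word) → k ≤ length w → count a (take k w) + count b (take k w) ≡ k
count-a+count-b-take k w k≤w = trans (count-a+count-b (take k w)) (trans (length-take k w) (m≤n⇒m⊓n≡m k≤w))

record Mechanical (n y : ℕ) (w : Word) : Set where
  field
    length≡ : length w ≡ n
    prefix  : ∀ k → k ≤ n → ⌊ k * y / n ⌋≡ count b (take k w)

open Mechanical

mechanical⇒NonZero : Mechanical n y w → NonZero n
mechanical⇒NonZero {w = w} mw =
  m*n≢0⇒n≢0 (suc (count b (take 0 w))) {{>-nonZero (upper (prefix mw 0 z≤n))}}

mechanical-count-b : Mechanical n y w → count b w ≡ y
mechanical-count-b {n} {y} {w} mw =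
  ⌊/⌋-unique (subst (λ w′ → ⌊ n * y / n ⌋≡ count b w′) all (prefix mw n ≤-refl)) (⌊n*y/n⌋≡y n y)
  where
  instance _ = mechanical⇒NonZero mw
  all : take n w ≡ w
  all = take-all n w (≤-reflexive (length≡ mw))

mechanical-++ : ∀ {n₁ y₁ n₂ y₂ u v} → y₂ * n₁ ≡ y₁ * n₂ + 1 →
  Mechanical n₁ y₁ u → Mechanical n₂ y₂ v → Mechanical (n₁ + n₂) (y₁ + y₂) (u ++ v)
mechanical-++ {n₁} {y₁} {n₂} {y₂} {u} {v} det mu mv = record
  { length≡ = trans (length-++ u) (cong₂ _+_ (length≡ mu) (length≡ mv))
  ; prefix  = prefix-++
  }
  where
  instance
    _ = mechanical⇒NonZero mu
    _ = mechanical⇒NonZero mv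
  open FareyMediant {n₁} {y₁} {n₂} {y₂} det
  n₁≡u : n₁ ≡ length u
  n₁≡u = sym (length≡ mu)
  prefixʳ : ∀ t → t ≤ n₂ → ⌊ (n₁ + t) * (y₁ + y₂) / (n₁ + n₂) ⌋≡ count b (take (n₁ + t) (u ++ v))
  prefixʳ t t≤n₂ = subst (⌊ (n₁ + t) * (y₁ + y₂) / (n₁ + n₂) ⌋≡_) (sym count-b-prefix)
                         (⌊/⌋-mediantʳ t≤n₂ (prefix mv t t≤n₂))
    where
    open ≡-Reasoning
    count-b-prefix : count b (take (n₁ + t) (u ++ v)) ≡ y₁ + count b (take t v)
    count-b-prefix = begin
      count b (take (n₁ + t) (u ++ v))       ≡⟨ cong (λ n → count b (take (n + t) (u ++ v))) n₁≡u ⟩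
      count b (take (length u + t) (u ++ v)) ≡⟨ cong (count b) (take-++ʳ t u v) ⟩
      count b (u ++ take t v)                ≡⟨ count-++ b u (take t v) ⟩
      count b u + count b (take t v)         ≡⟨ cong (_+ count b (take t v)) (mechanical-count-b mu) ⟩
      y₁ + count b (take t v)                ∎
  prefix-++ : ∀ k → k ≤ n₁ + n₂ → ⌊ k * (y₁ + y₂) / (n₁ + n₂) ⌋≡ count b (take k (u ++ v))
  prefix-++ k k≤n with k ≤? n₁
  ... | yes k≤n₁ = subst (⌊ k * (y₁ + y₂) / (n₁ + n₂) ⌋≡_)
                         (cong (count b) (sym (take-++ˡ k u v (subst (k ≤_) n₁≡u k≤n₁))))
                         (⌊/⌋-mediantˡ k≤n₁ (prefix mu k k≤n₁))
  ... | no k≰n₁ = subst (λ k → ⌊ k * (y₁ + y₂) / (n₁ + n₂) ⌋≡ count b (take k (u ++ v))) n₁+[k∸n₁]≡k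
                        (prefixʳ (k ∸ n₁) k∸n₁≤n₂)
    where
    n₁+[k∸n₁]≡k : n₁ + (k ∸ n₁) ≡ k
    n₁+[k∸n₁]≡k = m+[n∸m]≡n (<⇒≤ (≰⇒> k≰n₁))
    k∸n₁≤n₂ : k ∸ n₁ ≤ n₂
    k∸n₁≤n₂ = +-cancelˡ-≤ n₁ (k ∸ n₁) n₂ (subst (_≤ n₁ + n₂) (sym n₁+[k∸n₁]≡k) k≤n)

module _ {x y : ℕ} {w : Word} (mw : Mechanical (x + y) y w) where

  mechanical-count-a : count a w ≡ x
  mechanical-count-a = +-cancelʳ-≡ y (count a w) x (begin
    count a w + y         ≡⟨ cong (count a w +_) (mechanical-count-b mw) ⟨
    count a w + count b w ≡⟨ count-a+count-b w ⟩
    length w              ≡⟨ length≡ mw ⟩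
    x + y                 ∎)
    where open ≡-Reasoning

  mechanical-below : ∀ k → count b (take k w) * x ≤ count a (take k w) * y
  mechanical-below k with k ≤? x + y
  ... | yes k≤n = +-cancelʳ-≤ (#b * y) (#b * x) (#a * y) (begin
    #b * x + #b * y ≡⟨ *-distribˡ-+ #b x y ⟨
    #b * (x + y)    ≤⟨ lower (prefix mw k k≤n) ⟩
    k * y           ≡⟨ cong (_* y) (count-a+count-b-take k w (subst (k ≤_) (sym (length≡ mw)) k≤n)) ⟨
    (#a + #b) * y   ≡⟨ *-distribʳ-+ y #a #b ⟩
    #a * y + #b * y ∎)
    where
    open ≤-Reasoning
    #a = count a (take k w)
    #b = count b (take k w)
  ... | no k≰n rewrite take-all k w (subst (_≤ k) (sym (length≡ mw)) (<⇒≤ (≰⇒> k≰n)))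
                     | mechanical-count-a | mechanical-count-b mw = ≤-reflexive (*-comm y x)

  mechanical-noInterior : ∀ i j → i ≤ x → j * x < i * y →
                          ∃[ k ] (count a (take k w) ≡ i × j ≤ count b (take k w))
  -- The point (i, ⌊i y / x⌋) is the highest lattice point of column i not above
  -- the segment; the shear puts it on the path at the prefix of length i + ⌊i y / x⌋.
  mechanical-noInterior i j i≤x j*x<i*y = i + q , count-a≡i , j≤count-b
    where
    instance
      _ : NonZero i
      _ = m*n≢0⇒m≢0 i {{>-nonZero (≤-<-trans z≤n j*x<i*y)}}
      _ : NonZero x
      _ = >-nonZero (<-≤-trans (>-nonZero⁻¹ i) i≤x)
    q = i * y / x
    ⌊iy/x⌋≡q : ⌊ i * y / x ⌋≡ q
    ⌊iy/x⌋≡q = ⌊/⌋-divMod (i * y) x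
    q≤y : q ≤ y
    q≤y = *-cancelʳ-≤ q y x
            (≤-trans (lower ⌊iy/x⌋≡q) (≤-trans (*-monoˡ-≤ y i≤x) (≤-reflexive (*-comm x y))))
    i+q≤n : i + q ≤ x + y
    i+q≤n = +-mono-≤ i≤x q≤y
    count-b≡q : count b (take (i + q) w) ≡ q
    count-b≡q = ⌊/⌋-unique (prefix mw (i + q) i+q≤n) (⌊/⌋-shear {i} ⌊iy/x⌋≡q)
    count-a≡i : count a (take (i + q) w) ≡ i
    count-a≡i = +-cancelʳ-≡ q _ i (trans (cong (count a (take (i + q) w) +_) (sym count-b≡q))
                  (count-a+count-b-take (i + q) w (subst (i + q ≤_) (sym (length≡ mw)) i+q≤n)))
    j≤count-b : j ≤ count b (take (i + q) w)
    j≤count-b = subst (j ≤_) (sym count-b≡q)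
                  (≤-pred (*-cancelʳ-< x j (suc q) (<-trans j*x<i*y (upper ⌊iy/x⌋≡q))))

mechanical⇒lowerChristoffel : Coprime x y → Mechanical (x + y) y w → IsLowerChristoffel x y w
mechanical⇒lowerChristoffel coprime mw = record
  { coprime    = coprime
  ; endA       = mechanical-count-a mw
  ; endB       = mechanical-count-b mw
  ; below      = mechanical-below mw
  ; noInterior = mechanical-noInterior mw
  }

-- Farey pairs

unimodular⇒coprime : ∀ {p q r s} → p * q ≡ r * s + 1 → Coprime p s × Coprime r q
unimodular⇒coprime {p} {q} {r} {s} det =
  (λ {d} (d∣p , d∣s) → ∣1⇒≡1 (∣m+n∣m⇒∣n (subst (d ∣_) det (∣m⇒∣m*n q d∣p)) (∣n⇒∣m*n r d∣s))) ,
  (λ {d} (d∣r , d∣q) → ∣1⇒≡1 (∣m+n∣m⇒∣n (subst (d ∣_) det (∣n⇒∣m*n p d∣q)) (∣m⇒∣m*n s d∣r)))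

record FareyPair (u v : Word) : Set where
  constructor fareyPair
  field
    x₁ y₁ x₂ y₂ : ℕ
    mechanical₁ : Mechanical (x₁ + y₁) y₁ u
    mechanical₂ : Mechanical (x₂ + y₂) y₂ v
    det         : x₁ * y₂ ≡ x₂ * y₁ + 1

  christoffel₁ : IsChristoffel u
  christoffel₁ = x₁ , y₁ , mechanical⇒lowerChristoffel (proj₁ coprime) mechanical₁
    where coprime = unimodular⇒coprime {x₁} {y₂} {x₂} {y₁} det

  christoffel₂ : IsChristoffel v
  christoffel₂ = x₂ , y₂ , mechanical⇒lowerChristoffel (proj₂ coprime) mechanical₂
    where coprime = unimodular⇒coprime {x₁} {y₂} {x₂} {y₁} det

open FareyPair

fareyPair-mechanical-++ : (P : FareyPair u v) →
  Mechanical ((x₁ P + x₂ P) + (y₁ P + y₂ P)) (y₁ P + y₂ P) (u ++ v)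
fareyPair-mechanical-++ {u} {v} (fareyPair x₁ y₁ x₂ y₂ mu mv det) =
  subst (λ n → Mechanical n (y₁ + y₂) (u ++ v)) regroup (mechanical-++ det′ mu mv)
  where
  open ≡-Reasoning
  regroup : (x₁ + y₁) + (x₂ + y₂) ≡ (x₁ + x₂) + (y₁ + y₂)
  regroup = solve (x₁ ∷ y₁ ∷ x₂ ∷ y₂ ∷ [])
  det′ : y₂ * (x₁ + y₁) ≡ y₁ * (x₂ + y₂) + 1
  det′ = begin
    y₂ * (x₁ + y₁)        ≡⟨ solve (x₁ ∷ y₁ ∷ y₂ ∷ []) ⟩
    x₁ * y₂ + y₁ * y₂     ≡⟨ cong (_+ y₁ * y₂) det ⟩
    x₂ * y₁ + 1 + y₁ * y₂ ≡⟨ solve (x₂ ∷ y₁ ∷ y₂ ∷ []) ⟩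
    y₁ * (x₂ + y₂) + 1    ∎

fareyPair-left : FareyPair u v → FareyPair u (u ++ v)
fareyPair-left P@(fareyPair x₁ y₁ x₂ y₂ mu _ det) =
  fareyPair x₁ y₁ (x₁ + x₂) (y₁ + y₂) mu (fareyPair-mechanical-++ P) (begin
  x₁ * (y₁ + y₂)          ≡⟨ *-distribˡ-+ x₁ y₁ y₂ ⟩
  x₁ * y₁ + x₁ * y₂       ≡⟨ cong (x₁ * y₁ +_) det ⟩
  x₁ * y₁ + (x₂ * y₁ + 1) ≡⟨ solve (x₁ ∷ x₂ ∷ y₁ ∷ []) ⟩
  (x₁ + x₂) * y₁ + 1      ∎)
  where open ≡-Reasoning

fareyPair-right : FareyPair u v → FareyPair (u ++ v) v
fareyPair-right P@(fareyPair x₁ y₁ x₂ y₂ _ mv det) =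
  fareyPair (x₁ + x₂) (y₁ + y₂) x₂ y₂ (fareyPair-mechanical-++ P) mv (begin
  (x₁ + x₂) * y₂        ≡⟨ *-distribʳ-+ y₂ x₁ x₂ ⟩
  x₁ * y₂ + x₂ * y₂     ≡⟨ cong (_+ x₂ * y₂) det ⟩
  x₂ * y₁ + 1 + x₂ * y₂ ≡⟨ solve (x₂ ∷ y₁ ∷ y₂ ∷ []) ⟩
  x₂ * (y₁ + y₂) + 1    ∎)
  where open ≡-Reasoning

fareyPair-christoffel : FareyPair u v → IsChristoffel u × IsChristoffel v × IsChristoffel (u ++ v)
fareyPair-christoffel P = christoffel₁ P , christoffel₂ P , christoffel₁ (fareyPair-right P)

mechanical-a : Mechanical 1 0 (a ∷ [])
mechanical-a = record { length≡ = refl ; prefix = λ where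
  zero          _       → bounds z≤n (s≤s z≤n)
  (suc zero)    _       → bounds z≤n (s≤s z≤n)
  (suc (suc _)) (s≤s ()) }

mechanical-b : Mechanical 1 1 (b ∷ [])
mechanical-b = record { length≡ = refl ; prefix = λ where
  zero          _       → bounds z≤n (s≤s z≤n)
  (suc zero)    _       → bounds (s≤s z≤n) (s≤s (s≤s z≤n))
  (suc (suc _)) (s≤s ()) }

fareyPair-applyPath : ∀ p → FareyPair (applyPath p (a ∷ [])) (applyPath p (b ∷ []))
fareyPair-applyPath [] = fareyPair 1 0 0 1 mechanical-a mechanical-b refl
fareyPair-applyPath (L ∷ p) =
  subst (FareyPair (applyPath p (a ∷ []))) (sym (applyPath-++ p (a ∷ []) (b ∷ [])))
        (fareyPair-left (fareyPair-applyPath p))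
fareyPair-applyPath (R ∷ p) =
  subst (λ u → FareyPair u (applyPath p (b ∷ []))) (sym (applyPath-++ p (a ∷ []) (b ∷ [])))
        (fareyPair-right (fareyPair-applyPath p))

cohn-christoffel : ∀ (p : List Dir) →
    IsChristoffel (proj₁ (cohn p))
  × IsChristoffel (proj₂ (cohn p))
  × IsChristoffel (proj₁ (cohn p) ++ proj₂ (cohn p))
cohn-christoffel p rewrite cohnTripleFrom-applyPath p (a ∷ []) (b ∷ []) (a ∷ b ∷ []) =
  fareyPair-christoffel (fareyPair-applyPath p)

mainTheorem3 :
    (∀ (p : List Dir) →
        IsChristoffel (proj₁ (cohn p))
      × IsChristoffel (proj₂ (cohn p))
      × IsChristoffel (proj₁ (cohn p) ++ proj₂ (cohn p)))
    × (∀ (p : List Dir) →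
        (length (proj₁ (cohn p)) , length (proj₂ (cohn p))) ≈F sternBrocot p)
    × (∀ (p : List Dir) →
        (count b (proj₁ (cohn p) ++ proj₂ (cohn p))
          , count a (proj₁ (cohn p) ++ proj₂ (cohn p))) ≈F calkinWilf p)
mainTheorem3 = cohn-christoffel , cohn-sternBrocot , cohn-calkinWilf
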